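{- For any positive integer $n$, \[ 2^{n}tA_n(t)=B_n^{ - }(t)+tB_n^{+}(t). \]
   Context: $A_n(t)=\sum_{\pi}t^{\mathrm{des}(\pi)}$ over all permutations $\pi$ of $[n]$, with $\mathrm{des}(\pi)=|\{i\in[n-1]:\pi_i>\pi_{i+1}\}|$. $\mathfrak{B}_n$ is the set of signed permutations $\pi=\pi_1\cdots\pi_n$ of $[n]$; with $\pi_0=0$, $\mathrm{des}_B(\pi)=|\{i\in\{0,\dots,n-1\}:\pi_i>\pi_{i+1}\}|$. $B_n^{+}(t)=\sum_{\pi\in\mathfrak{B}_n,\,\pi_n>0}t^{\mathrm{des}_B(\pi)}$ and $B_n^{ - }(t)=\sum_{\pi\in\mathfrak{B}_n,\,\pi_n<0}t^{\mathrm{des}_B(\pi)}$. -}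

module Defs where

open import Data.Nat using (ℕ; zero; suc; _+_; _*_; _<ᵇ_; _≡ᵇ_)
open import Data.Integer as ℤ using (ℤ; +_; -_; -[1+_])
open import Data.Bool using (Bool; true; false; if_then_else_)
open import Data.List using (List; []; _∷_; map; concatMap; length; filter; upTo)
open import Data.Nat.Properties using (_≟_)
open import Relation.Nullary.Decidable using (⌊_⌋)

insertions : {A : Set} → A → List A → List (List A)
insertions x [] = (x ∷ []) ∷ []
insertions x (y ∷ ys) = (x ∷ y ∷ ys) ∷ map (y ∷_) (insertions x ys)

perms : ℕ → List (List ℕ)
perms zero = [] ∷ []
perms (suc n) = concatMap (insertions (suc n)) (perms n)

signings : List ℕ → List (List ℤ)
signings [] = [] ∷ []
signings (x ∷ xs) = concatMap (λ s → (+ x ∷ s) ∷ (ℤ.- (+ x) ∷ s) ∷ []) (signings xs)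

-- The hyperoctahedral group 𝔅_n: all signed permutations of [n], one-line notation.
signedPerms : ℕ → List (List ℤ)
signedPerms n = concatMap signings (perms n)

des : List ℕ → ℕ
des [] = 0
des (x ∷ []) = 0
des (x ∷ y ∷ ys) = (if y <ᵇ x then 1 else 0) + des (y ∷ ys)

desZ : List ℤ → ℕ
desZ [] = 0
desZ (x ∷ []) = 0
desZ (x ∷ y ∷ ys) = (if ⌊ y ℤ.<? x ⌋ then 1 else 0) + desZ (y ∷ ys)

desB : List ℤ → ℕ
desB π = desZ (+ 0 ∷ π)

lastPos : List ℤ → Bool
lastPos [] = false
lastPos (x ∷ []) = ⌊ + 0 ℤ.<? x ⌋
lastPos (x ∷ y ∷ ys) = lastPos (y ∷ ys)

lastNeg : List ℤ → Bool
lastNeg [] = false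
lastNeg (x ∷ []) = ⌊ x ℤ.<? + 0 ⌋
lastNeg (x ∷ y ∷ ys) = lastNeg (y ∷ ys)

-- Polynomials in t with ℕ coefficients, represented by their coefficient functions.
Poly : Set
Poly = ℕ → ℕ

t·_ : Poly → Poly
(t· p) zero = 0
(t· p) (suc k) = p k

_⊕_ : Poly → Poly → Poly
(p ⊕ q) k = p k + q k

_•_ : ℕ → Poly → Poly
(c • p) k = c * p k

infixr 6 _⊕_
infixr 7 _•_
infixr 8 t·_

genPoly : {A : Set} → (A → ℕ) → List A → Poly
genPoly stat L k = length (filter (λ π → k ≟ stat π) L)

Aₙ : ℕ → Poly
Aₙ n = genPoly des (perms n)

Bₙ⁺ : ℕ → Poly
Bₙ⁺ n = genPoly desB (filter (λ π → Data.Bool._≟_ (lastPos π) true) (signedPerms n))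

Bₙ⁻ : ℕ → Poly
Bₙ⁻ n = genPoly desB (filter (λ π → Data.Bool._≟_ (lastNeg π) true) (signedPerms n))

module Submission where

-- Let desB⁰ σ be the number of descents of the word 0 σ 0.  It is desB σ plus one exactly
-- when σ ends positively, so B⁻ₙ + t B⁺ₙ is the descent polynomial of 0 σ 0 over 𝔅ₙ, while
-- t Aₙ is the polynomial of 1 + des over permutations of [n].  Inserting a letter larger (or
-- smaller) than all others into a word with g gaps, d of them descents, yields d words with
-- d descents and g − d words with d + 1.  Inserting ±(n+1) into 0 σ 0 (n + 1 gaps) and n+1
-- into π (n + 1 gaps, of which the des π descents and the end keep the count) thus
-- transform desB⁰ and 1 + des by the same recurrence, the signed one with a factor 2, and
-- both sides agree for n = 1.  Polynomials are compared coefficientwise, i.e. through sums ∑ f (stat)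
-- for an arbitrary weight f : ℕ → ℕ.

open import Defs
open import Data.Bool using (Bool; true; false; not; if_then_else_)
import Data.Bool as Bool
open import Data.Bool.Properties using (T-≡)
open import Data.Integer as ℤ using (ℤ; +0; +[1+_]; -[1+_]; ∣_∣; -<-; -<+; +<+) renaming (+_ to pos)
open import Data.Integer.Properties using (∣-i∣≡∣i∣) renaming (<-asym to <-asymℤ)
open import Data.List using (List; []; _∷_; _++_; map; concatMap; length; filter)
open import Data.List.Properties using (length-map; length-++)
open import Data.List.Relation.Unary.All as All using (All; []; _∷_)
open import Data.List.Relation.Unary.All.Properties using (concat⁺; map⁺; map⁻; ++⁺)
open import Data.Nat using (ℕ; zero; suc; _+_; _*_; _∸_; _^_; _≤_; _<_; _<ᵇ_; _≡ᵇ_; z≤n; s≤s)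
open import Data.Nat.Properties
  using (+-assoc; +-comm; +-identityʳ; +-suc; +-∸-assoc; *-assoc; *-comm; *-zeroʳ; *-distribˡ-+;
         ≤-refl; m≤n⇒m≤1+n; +-mono-≤; <⇒≤; <⇒<ᵇ; +-commutativeSemigroup)
open import Data.Product using (_×_; _,_; proj₁; proj₂)
open import Data.Sum as Sum using (_⊎_; inj₁; inj₂)
open import Function using (_∘_; Equivalence)
open import Relation.Nullary using (¬_)
open import Relation.Nullary.Decidable using (⌊_⌋; isYes≗does; dec-true; dec-false)
open import Relation.Binary.PropositionalEquality
open ≡-Reasoning

open import Algebra.Properties.CommutativeSemigroup +-commutativeSemigroup using (interchange; x∙yz≈y∙xz)

∑ : {A : Set} → List A → (A → ℕ) → ℕ
∑ [] w = 0
∑ (x ∷ xs) w = w x + ∑ xs w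

syntax ∑ L (λ x → w) = ∑[ x ∈ L ] w

module _ {A : Set} where

  ∑-++ : (xs ys : List A) (w : A → ℕ) → ∑ (xs ++ ys) w ≡ ∑ xs w + ∑ ys w
  ∑-++ [] ys w = refl
  ∑-++ (x ∷ xs) ys w = trans (cong (w x +_) (∑-++ xs ys w)) (sym (+-assoc (w x) _ _))

  ∑-cong-All : {L : List A} {v w : A → ℕ} → All (λ x → v x ≡ w x) L → ∑ L v ≡ ∑ L w
  ∑-cong-All [] = refl
  ∑-cong-All (e ∷ es) = cong₂ _+_ e (∑-cong-All es)

  ∑-cong : (L : List A) {v w : A → ℕ} → (∀ x → v x ≡ w x) → ∑ L v ≡ ∑ L w
  ∑-cong L e = ∑-cong-All (All.universal e L)

  ∑-zero : (L : List A) → ∑[ x ∈ L ] 0 ≡ 0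
  ∑-zero [] = refl
  ∑-zero (x ∷ L) = ∑-zero L

  ∑-distrib-+ : (L : List A) (v w : A → ℕ) → ∑[ x ∈ L ] (v x + w x) ≡ ∑ L v + ∑ L w
  ∑-distrib-+ [] v w = refl
  ∑-distrib-+ (x ∷ L) v w = trans (cong (v x + w x +_) (∑-distrib-+ L v w)) (interchange (v x) (w x) _ _)

  ∑-*ˡ : (c : ℕ) (L : List A) (w : A → ℕ) → ∑[ x ∈ L ] (c * w x) ≡ c * ∑ L w
  ∑-*ˡ c [] w = sym (*-zeroʳ c)
  ∑-*ˡ c (x ∷ L) w = trans (cong (c * w x +_) (∑-*ˡ c L w)) (sym (*-distribˡ-+ c (w x) _))

  ∑-filterᵇ : (p : A → Bool) (L : List A) (w : A → ℕ) →
              ∑ (filter (λ x → p x Bool.≟ true) L) w ≡ ∑[ x ∈ L ] (if p x then w x else 0)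
  ∑-filterᵇ p [] w = refl
  ∑-filterᵇ p (x ∷ L) w with p x
  ... | true = cong (w x +_) (∑-filterᵇ p L w)
  ... | false = ∑-filterᵇ p L w

∑-swap : {A B : Set} (L : List A) (M : List B) (w : A → B → ℕ) →
         ∑[ x ∈ L ] ∑[ y ∈ M ] w x y ≡ ∑[ y ∈ M ] ∑[ x ∈ L ] w x y
∑-swap [] M w = sym (∑-zero M)
∑-swap (x ∷ L) M w = trans (cong (∑ M (w x) +_) (∑-swap L M w)) (sym (∑-distrib-+ M (w x) _))

∑-map : {A B : Set} (h : A → B) (L : List A) (w : B → ℕ) → ∑ (map h L) w ≡ ∑[ x ∈ L ] w (h x)
∑-map h [] w = refl
∑-map h (x ∷ L) w = cong (w (h x) +_) (∑-map h L w)

∑-concatMap : {A B : Set} (g : A → List B) (L : List A) (w : B → ℕ) →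
              ∑ (concatMap g L) w ≡ ∑[ x ∈ L ] ∑ (g x) w
∑-concatMap g [] w = refl
∑-concatMap g (x ∷ L) w = trans (∑-++ (g x) (concatMap g L) w) (cong (∑ (g x) w +_) (∑-concatMap g L w))

-- Definitionally the summand of des and desZ.
𝟙 : Bool → ℕ
𝟙 b = if b then 1 else 0

genPoly-∑ : {A : Set} (stat : A → ℕ) (L : List A) (k : ℕ) → genPoly stat L k ≡ ∑[ x ∈ L ] 𝟙 (k ≡ᵇ stat x)
genPoly-∑ stat [] k = refl
genPoly-∑ stat (x ∷ L) k with k ≡ᵇ stat x
... | true = cong suc (genPoly-∑ stat L k)
... | false = genPoly-∑ stat L k

t·-genPoly : {A : Set} (stat : A → ℕ) (L : List A) (k : ℕ) → (t· genPoly stat L) k ≡ genPoly (suc ∘ stat) L k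
t·-genPoly stat L zero = sym (trans (genPoly-∑ (suc ∘ stat) L zero) (∑-zero L))
t·-genPoly stat L (suc k) = trans (genPoly-∑ stat L k) (sym (genPoly-∑ (suc ∘ stat) L (suc k)))

genPoly-filterᵇ : {A : Set} (stat : A → ℕ) (p : A → Bool) (L : List A) (k : ℕ) →
  genPoly stat (filter (λ x → p x Bool.≟ true) L) k ≡ ∑[ x ∈ L ] (if p x then 𝟙 (k ≡ᵇ stat x) else 0)
genPoly-filterᵇ stat p L k =
  trans (genPoly-∑ stat (filter (λ x → p x Bool.≟ true) L) k) (∑-filterᵇ p L (λ x → 𝟙 (k ≡ᵇ stat x)))

𝟙≤1 : ∀ b → 𝟙 b ≤ 1
𝟙≤1 true = ≤-refl
𝟙≤1 false = z≤n

des≤length : ∀ x l → des (x ∷ l) ≤ length l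
des≤length x [] = z≤n
des≤length x (y ∷ l) = +-mono-≤ (𝟙≤1 (y <ᵇ x)) (des≤length y l)

desZ≤length : ∀ x l → desZ (x ∷ l) ≤ length l
desZ≤length x [] = z≤n
desZ≤length x (y ∷ l) = +-mono-≤ (𝟙≤1 ⌊ y ℤ.<? x ⌋) (desZ≤length y l)

des-0∷ : ∀ π → des (0 ∷ π) ≡ des π
des-0∷ [] = refl
des-0∷ (y ∷ π) = refl

<⇒<ᵇ≡true : ∀ {x y} → x < y → (x <ᵇ y) ≡ true
<⇒<ᵇ≡true x<y = Equivalence.to T-≡ (<⇒<ᵇ x<y)

≥⇒<ᵇ≡false : ∀ {x y} → y ≤ x → (x <ᵇ y) ≡ false
≥⇒<ᵇ≡false {y = zero} _ = refl
≥⇒<ᵇ≡false {suc x} {suc y} (s≤s y≤x) = ≥⇒<ᵇ≡false y≤x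

<⇒⌊<?⌋≡true : ∀ {x y} → x ℤ.< y → ⌊ x ℤ.<? y ⌋ ≡ true
<⇒⌊<?⌋≡true {x} {y} x<y = trans (isYes≗does (x ℤ.<? y)) (dec-true (x ℤ.<? y) x<y)

≮⇒⌊<?⌋≡false : ∀ {x y} → ¬ x ℤ.< y → ⌊ x ℤ.<? y ⌋ ≡ false
≮⇒⌊<?⌋≡false {x} {y} x≮y = trans (isYes≗does (x ℤ.<? y)) (dec-false (x ℤ.<? y) x≮y)

∣i∣≤n⇒i<+[1+n] : ∀ {n} z → ∣ z ∣ ≤ n → z ℤ.< +[1+ n ]
∣i∣≤n⇒i<+[1+n] (pos x) x≤n = +<+ (s≤s x≤n)
∣i∣≤n⇒i<+[1+n] -[1+ x ] _ = -<+

∣i∣≤n⇒-[1+n]<i : ∀ {n} z → ∣ z ∣ ≤ n → -[1+ n ] ℤ.< z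
∣i∣≤n⇒-[1+n]<i (pos x) _ = -<+
∣i∣≤n⇒-[1+n]<i -[1+ x ] x<n = -<- x<n

-- The total weight, under f, of the g words obtained by inserting an extreme letter into a
-- word with g gaps and d descents (see the header).
eulerStep : ℕ → (ℕ → ℕ) → ℕ → ℕ
eulerStep g f d = d * f d + (g ∸ d) * f (suc d)

eulerStep-1 : ∀ {d} (f : ℕ → ℕ) → d ≤ 1 → eulerStep 1 f d ≡ f 1 + 0
eulerStep-1 f z≤n = refl
eulerStep-1 f (s≤s z≤n) = +-identityʳ (f 1 + 0)

eulerStep-∷ : ∀ b g (f : ℕ → ℕ) d → d ≤ g →
              f (suc d) + eulerStep g (λ e → f (𝟙 b + e)) d ≡ eulerStep (suc g) f (𝟙 b + d)
eulerStep-∷ true g f d _ = sym (+-assoc (f (suc d)) (d * f (suc d)) _)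
eulerStep-∷ false g f d d≤g = begin
    f (suc d) + (d * f d + (g ∸ d) * f (suc d))
  ≡⟨ x∙yz≈y∙xz (f (suc d)) (d * f d) _ ⟩
    d * f d + suc (g ∸ d) * f (suc d)
  ≡⟨ cong (λ h → d * f d + h * f (suc d)) (sym (+-∸-assoc 1 d≤g)) ⟩
    d * f d + (suc g ∸ d) * f (suc d)
  ∎

∑-insertions-∷ : {A : Set} (c y : A) (ys : List A) (w : List A → ℕ) →
                 ∑ (insertions c (y ∷ ys)) w ≡ w (c ∷ y ∷ ys) + ∑[ σ ∈ insertions c ys ] w (y ∷ σ)
∑-insertions-∷ c y ys w = cong (w (c ∷ y ∷ ys) +_) (∑-map (y ∷_) (insertions c ys) w)

des-max : ∀ {m} a y w → a < m → y < m → des (a ∷ m ∷ y ∷ w) ≡ suc (des (y ∷ w))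
des-max a y w a<m y<m rewrite ≥⇒<ᵇ≡false (<⇒≤ a<m) | <⇒<ᵇ≡true y<m = refl

∑-insertions-max : ∀ {m} a π → All (_< m) (a ∷ π) → (f : ℕ → ℕ) →
  ∑[ π' ∈ insertions m π ] f (suc (des (a ∷ π'))) ≡ eulerStep (suc (length π)) f (suc (des (a ∷ π)))
∑-insertions-max {m} a [] (a<m ∷ []) f rewrite ≥⇒<ᵇ≡false (<⇒≤ a<m) = sym (eulerStep-1 f ≤-refl)
∑-insertions-max {m} a (y ∷ ys) (a<m ∷ y<m ∷ ys<m) f = begin
    ∑[ π' ∈ insertions m (y ∷ ys) ] f (suc (des (a ∷ π')))
  ≡⟨ ∑-insertions-∷ m y ys (λ π' → f (suc (des (a ∷ π')))) ⟩
    f (suc (des (a ∷ m ∷ y ∷ ys))) + ∑[ π' ∈ insertions m ys ] f (suc (b + des (y ∷ π')))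
  ≡⟨ cong₂ _+_ (cong (f ∘ suc) (des-max a y ys a<m y<m))
               (∑-cong (insertions m ys) (λ π' → cong f (sym (+-suc b (des (y ∷ π')))))) ⟩
    f (suc (suc d)) + ∑[ π' ∈ insertions m ys ] f (b + suc (des (y ∷ π')))
  ≡⟨ cong (f (suc (suc d)) +_) (∑-insertions-max y ys (y<m ∷ ys<m) (λ e → f (b + e))) ⟩
    f (suc (suc d)) + eulerStep (suc (length ys)) (λ e → f (b + e)) (suc d)
  ≡⟨ eulerStep-∷ (y <ᵇ a) (suc (length ys)) f (suc d) (s≤s (des≤length y ys)) ⟩
    eulerStep (suc (suc (length ys))) f (b + suc d)
  ≡⟨ cong (eulerStep (suc (suc (length ys))) f) (+-suc b d) ⟩
    eulerStep (suc (suc (length ys))) f (suc (b + d))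
  ∎
  where
  b = 𝟙 (y <ᵇ a)
  d = des (y ∷ ys)

Extreme : ℤ → List ℤ → Set
Extreme c w = All (ℤ._< c) w ⊎ All (c ℤ.<_) w

desZ-extreme : ∀ {c} a y w → Extreme c (a ∷ y ∷ w) → desZ (a ∷ c ∷ y ∷ w) ≡ suc (desZ (y ∷ w))
desZ-extreme a y w (inj₁ (a<c ∷ y<c ∷ _)) rewrite ≮⇒⌊<?⌋≡false (<-asymℤ a<c) | <⇒⌊<?⌋≡true y<c = refl
desZ-extreme a y w (inj₂ (c<a ∷ c<y ∷ _)) rewrite <⇒⌊<?⌋≡true c<a | ≮⇒⌊<?⌋≡false (<-asymℤ c<y) = refl

∑-insertions-extreme : ∀ {c} a σ z → Extreme c (a ∷ σ ++ z ∷ []) → (f : ℕ → ℕ) →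
  ∑[ σ' ∈ insertions c σ ] f (desZ (a ∷ σ' ++ z ∷ []))
    ≡ eulerStep (length (σ ++ z ∷ [])) f (desZ (a ∷ σ ++ z ∷ []))
∑-insertions-extreme {c} a [] z ext f = begin
    f (desZ (a ∷ c ∷ z ∷ [])) + 0
  ≡⟨ cong (λ d → f d + 0) (desZ-extreme a z [] ext) ⟩
    f 1 + 0
  ≡⟨ sym (eulerStep-1 f (desZ≤length a (z ∷ []))) ⟩
    eulerStep 1 f (desZ (a ∷ z ∷ []))
  ∎
∑-insertions-extreme {c} a (y ∷ ys) z ext f = begin
    ∑[ σ' ∈ insertions c (y ∷ ys) ] f (desZ (a ∷ σ' ++ z ∷ []))
  ≡⟨ ∑-insertions-∷ c y ys (λ σ' → f (desZ (a ∷ σ' ++ z ∷ []))) ⟩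
    f (desZ (a ∷ c ∷ y ∷ ys ++ z ∷ [])) + ∑[ σ' ∈ insertions c ys ] f (b + desZ (y ∷ σ' ++ z ∷ []))
  ≡⟨ cong₂ _+_ (cong f (desZ-extreme a y _ ext))
               (∑-insertions-extreme y ys z (Sum.map All.tail All.tail ext) (λ e → f (b + e))) ⟩
    f (suc d) + eulerStep (length (ys ++ z ∷ [])) (λ e → f (b + e)) d
  ≡⟨ eulerStep-∷ ⌊ y ℤ.<? a ⌋ _ f d (desZ≤length y (ys ++ z ∷ [])) ⟩
    eulerStep (length (y ∷ ys ++ z ∷ [])) f (b + d)
  ∎
  where
  b = 𝟙 ⌊ y ℤ.<? a ⌋
  d = desZ (y ∷ ys ++ z ∷ [])

± : ℕ → List ℤ
± x = pos x ∷ ℤ.- pos x ∷ []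

∑-signings-∷ : ∀ x xs (w : List ℤ → ℕ) →
               ∑ (signings (x ∷ xs)) w ≡ ∑[ s ∈ signings xs ] ∑[ x' ∈ ± x ] w (x' ∷ s)
∑-signings-∷ x xs w = ∑-concatMap _ (signings xs) w

∑-insertions-signings : ∀ m π (w : List ℤ → ℕ) →
  ∑[ π' ∈ insertions m π ] ∑ (signings π') w ≡ ∑[ σ ∈ signings π ] ∑[ c ∈ ± m ] ∑ (insertions c σ) w
∑-insertions-signings m [] w = cong (_+ 0) (∑-cong (± m) (λ c → sym (+-identityʳ (w (c ∷ [])))))
∑-insertions-signings m (y ∷ ys) w = begin
    ∑ (signings (m ∷ y ∷ ys)) w + ∑[ π' ∈ map (y ∷_) (insertions m ys) ] ∑ (signings π') w
  ≡⟨ cong₂ _+_ (trans (∑-signings-∷ m (y ∷ ys) w) (∑-signings-∷ y ys _)) inserted-after-y ⟩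
    ∑[ s ∈ signings ys ] ∑[ y' ∈ ± y ] ∑[ c ∈ ± m ] w (c ∷ y' ∷ s)
      + ∑[ s ∈ signings ys ] ∑[ c ∈ ± m ] ∑ (insertions c s) w'
  ≡⟨ sym (∑-distrib-+ (signings ys) (λ s → ∑[ y' ∈ ± y ] ∑[ c ∈ ± m ] w (c ∷ y' ∷ s))
                                    (λ s → ∑[ c ∈ ± m ] ∑ (insertions c s) w')) ⟩
    ∑[ s ∈ signings ys ] (∑[ y' ∈ ± y ] ∑[ c ∈ ± m ] w (c ∷ y' ∷ s) + ∑[ c ∈ ± m ] ∑ (insertions c s) w')
  ≡⟨ ∑-cong (signings ys) (λ s → sym (unfold-insertions s)) ⟩
    ∑[ s ∈ signings ys ] ∑[ y' ∈ ± y ] ∑[ c ∈ ± m ] ∑ (insertions c (y' ∷ s)) w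
  ≡⟨ sym (∑-signings-∷ y ys _) ⟩
    ∑[ σ ∈ signings (y ∷ ys) ] ∑[ c ∈ ± m ] ∑ (insertions c σ) w
  ∎
  where
  w' : List ℤ → ℕ
  w' σ = ∑[ y' ∈ ± y ] w (y' ∷ σ)
  inserted-after-y : ∑[ π' ∈ map (y ∷_) (insertions m ys) ] ∑ (signings π') w
          ≡ ∑[ s ∈ signings ys ] ∑[ c ∈ ± m ] ∑ (insertions c s) w'
  inserted-after-y = begin
      ∑[ π' ∈ map (y ∷_) (insertions m ys) ] ∑ (signings π') w
    ≡⟨ ∑-map (y ∷_) (insertions m ys) _ ⟩
      ∑[ π' ∈ insertions m ys ] ∑ (signings (y ∷ π')) w
    ≡⟨ ∑-cong (insertions m ys) (λ π' → ∑-signings-∷ y π' w) ⟩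
      ∑[ π' ∈ insertions m ys ] ∑ (signings π') w'
    ≡⟨ ∑-insertions-signings m ys w' ⟩
      ∑[ s ∈ signings ys ] ∑[ c ∈ ± m ] ∑ (insertions c s) w'
    ∎
  unfold-insertions : ∀ s → ∑[ y' ∈ ± y ] ∑[ c ∈ ± m ] ∑ (insertions c (y' ∷ s)) w
                 ≡ ∑[ y' ∈ ± y ] ∑[ c ∈ ± m ] w (c ∷ y' ∷ s) + ∑[ c ∈ ± m ] ∑ (insertions c s) w'
  unfold-insertions s = begin
      ∑[ y' ∈ ± y ] ∑[ c ∈ ± m ] ∑ (insertions c (y' ∷ s)) w
    ≡⟨ ∑-cong (± y) (λ y' → ∑-cong (± m) (λ c → ∑-insertions-∷ c y' s w)) ⟩
      ∑[ y' ∈ ± y ] ∑[ c ∈ ± m ] (w (c ∷ y' ∷ s) + ∑[ σ ∈ insertions c s ] w (y' ∷ σ))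
    ≡⟨ ∑-cong (± y) (λ y' → ∑-distrib-+ (± m) (λ c → w (c ∷ y' ∷ s))
                                              (λ c → ∑[ σ ∈ insertions c s ] w (y' ∷ σ))) ⟩
      ∑[ y' ∈ ± y ] (∑[ c ∈ ± m ] w (c ∷ y' ∷ s) + ∑[ c ∈ ± m ] ∑[ σ ∈ insertions c s ] w (y' ∷ σ))
    ≡⟨ ∑-distrib-+ (± y) (λ y' → ∑[ c ∈ ± m ] w (c ∷ y' ∷ s))
                         (λ y' → ∑[ c ∈ ± m ] ∑[ σ ∈ insertions c s ] w (y' ∷ σ)) ⟩
      ∑[ y' ∈ ± y ] ∑[ c ∈ ± m ] w (c ∷ y' ∷ s)
        + ∑[ y' ∈ ± y ] ∑[ c ∈ ± m ] ∑[ σ ∈ insertions c s ] w (y' ∷ σ)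
    ≡⟨ cong (∑[ y' ∈ ± y ] ∑[ c ∈ ± m ] w (c ∷ y' ∷ s) +_)
            (trans (∑-swap (± y) (± m) (λ y' c → ∑[ σ ∈ insertions c s ] w (y' ∷ σ)))
                   (∑-cong (± m) (λ c → ∑-swap (± y) (insertions c s) (λ y' σ → w (y' ∷ σ))))) ⟩
      ∑[ y' ∈ ± y ] ∑[ c ∈ ± m ] w (c ∷ y' ∷ s) + ∑[ c ∈ ± m ] ∑ (insertions c s) w'
    ∎

insertions-length : {A : Set} (x : A) (π : List A) → All (λ π' → length π' ≡ suc (length π)) (insertions x π)
insertions-length x [] = refl ∷ []
insertions-length x (y ∷ ys) = refl ∷ map⁺ (All.map (cong suc) (insertions-length x ys))

insertions-All : {A : Set} {P : A → Set} {x : A} {π : List A} → P x → All P π → All (All P) (insertions x π)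
insertions-All px [] = (px ∷ []) ∷ []
insertions-All px (py ∷ pys) = (px ∷ py ∷ pys) ∷ map⁺ (All.map (py ∷_) (insertions-All px pys))

InRange : ℕ → ℕ → Set
InRange n x = 1 ≤ x × x ≤ n

perms-length : ∀ n → All (λ π → length π ≡ n) (perms n)
perms-length zero = refl ∷ []
perms-length (suc n) = concat⁺ (map⁺ (All.map grow (perms-length n)))
  where
  grow : ∀ {π} → length π ≡ n → All (λ π' → length π' ≡ suc n) (insertions (suc n) π)
  grow {π} refl = insertions-length (suc n) π

perms-letters : ∀ n → All (All (InRange n)) (perms n)
perms-letters zero = [] ∷ []
perms-letters (suc n) = concat⁺ (map⁺ (All.map grow (perms-letters n)))
  where
  grow : ∀ {π} → All (InRange n) π → All (All (InRange (suc n))) (insertions (suc n) π)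
  grow ls = insertions-All (s≤s z≤n , ≤-refl) (All.map (λ (1≤x , x≤n) → 1≤x , m≤n⇒m≤1+n x≤n) ls)

signings-∣∣ : ∀ π → All (λ σ → map ∣_∣ σ ≡ π) (signings π)
signings-∣∣ [] = refl ∷ []
signings-∣∣ (x ∷ xs) =
  concat⁺ (map⁺ (All.map (λ e → cong (x ∷_) e ∷ cong₂ _∷_ (∣-i∣≡∣i∣ (pos x)) e ∷ []) (signings-∣∣ xs)))

signedPerms-length : ∀ n → All (λ σ → length σ ≡ n) (signedPerms n)
signedPerms-length n = concat⁺ (map⁺ (All.map (λ {π} → signed {π}) (perms-length n)))
  where
  signed : ∀ {π} → length π ≡ n → All (λ σ → length σ ≡ n) (signings π)
  signed {π} refl = All.map (λ {σ} e → trans (sym (length-map ∣_∣ σ)) (cong length e)) (signings-∣∣ π)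

signedPerms-letters : ∀ n → All (All (InRange n ∘ ∣_∣)) (signedPerms n)
signedPerms-letters n = concat⁺ (map⁺ (All.map (λ {π} → signed {π}) (perms-letters n)))
  where
  signed : ∀ {π} → All (InRange n) π → All (All (InRange n ∘ ∣_∣)) (signings π)
  signed {π} ls = All.map (λ e → map⁻ (subst (All _) (sym e) ls)) (signings-∣∣ π)

∑-perms-suc : ∀ n (f : ℕ → ℕ) →
  ∑[ π ∈ perms (suc n) ] f (suc (des π)) ≡ ∑[ π ∈ perms n ] eulerStep (suc n) f (suc (des π))
∑-perms-suc n f = begin
    ∑[ π ∈ perms (suc n) ] f (suc (des π))
  ≡⟨ ∑-concatMap (insertions (suc n)) (perms n) _ ⟩
    ∑[ π ∈ perms n ] ∑[ π' ∈ insertions (suc n) π ] f (suc (des π'))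
  ≡⟨ ∑-cong-All (All.zipWith insert (perms-length n , perms-letters n)) ⟩
    ∑[ π ∈ perms n ] eulerStep (suc n) f (suc (des π))
  ∎
  where
  insert : ∀ {π} → length π ≡ n × All (InRange n) π →
           ∑[ π' ∈ insertions (suc n) π ] f (suc (des π')) ≡ eulerStep (suc n) f (suc (des π))
  insert {π} (refl , ls) = begin
      ∑[ π' ∈ insertions (suc n) π ] f (suc (des π'))
    ≡⟨ ∑-cong (insertions (suc n) π) (λ π' → cong (f ∘ suc) (sym (des-0∷ π'))) ⟩
      ∑[ π' ∈ insertions (suc n) π ] f (suc (des (0 ∷ π')))
    ≡⟨ ∑-insertions-max 0 π (s≤s z≤n ∷ All.map (λ (_ , x≤n) → s≤s x≤n) ls) f ⟩
      eulerStep (suc n) f (suc (des (0 ∷ π)))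
    ≡⟨ cong (eulerStep (suc n) f ∘ suc) (des-0∷ π) ⟩
      eulerStep (suc n) f (suc (des π))
    ∎

desB⁰ : List ℤ → ℕ
desB⁰ σ = desZ (+0 ∷ σ ++ +0 ∷ [])

∑-signedPerms-suc : ∀ n (f : ℕ → ℕ) →
  ∑[ σ ∈ signedPerms (suc n) ] f (desB⁰ σ) ≡ ∑[ σ ∈ signedPerms n ] (2 * eulerStep (suc n) f (desB⁰ σ))
∑-signedPerms-suc n f = begin
    ∑[ σ ∈ signedPerms (suc n) ] f (desB⁰ σ)
  ≡⟨ ∑-concatMap signings (perms (suc n)) _ ⟩
    ∑[ π' ∈ perms (suc n) ] ∑[ σ ∈ signings π' ] f (desB⁰ σ)
  ≡⟨ ∑-concatMap (insertions (suc n)) (perms n) _ ⟩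
    ∑[ π ∈ perms n ] ∑[ π' ∈ insertions (suc n) π ] ∑[ σ ∈ signings π' ] f (desB⁰ σ)
  ≡⟨ ∑-cong (perms n) (λ π → ∑-insertions-signings (suc n) π (f ∘ desB⁰)) ⟩
    ∑[ π ∈ perms n ] ∑[ σ ∈ signings π ] ∑[ c ∈ ± (suc n) ] ∑[ σ' ∈ insertions c σ ] f (desB⁰ σ')
  ≡⟨ sym (∑-concatMap signings (perms n) _) ⟩
    ∑[ σ ∈ signedPerms n ] ∑[ c ∈ ± (suc n) ] ∑[ σ' ∈ insertions c σ ] f (desB⁰ σ')
  ≡⟨ ∑-cong-All (All.zipWith insert (signedPerms-length n , signedPerms-letters n)) ⟩
    ∑[ σ ∈ signedPerms n ] (2 * eulerStep (suc n) f (desB⁰ σ))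
  ∎
  where
  insert : ∀ {σ} → length σ ≡ n × All (InRange n ∘ ∣_∣) σ →
           ∑[ c ∈ ± (suc n) ] ∑[ σ' ∈ insertions c σ ] f (desB⁰ σ') ≡ 2 * eulerStep (suc n) f (desB⁰ σ)
  insert {σ} (len , ls) =
    -- both the sum over ± (suc n) and 2 * _ unfold to x + (y + 0)
    cong₂ (λ x y → x + (y + 0)) (extreme (inj₁ (pad 0<c (All.map (∣i∣≤n⇒i<+[1+n] _ ∘ proj₂) ls))))
                                (extreme (inj₂ (pad -<+ (All.map (∣i∣≤n⇒-[1+n]<i _ ∘ proj₂) ls))))
    where
    0<c : +0 ℤ.< +[1+ n ]
    0<c = +<+ (s≤s z≤n)
    pad : ∀ {P : ℤ → Set} → P +0 → All P σ → All P (+0 ∷ σ ++ +0 ∷ [])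
    pad p ps = p ∷ ++⁺ ps (p ∷ [])
    gaps : length (σ ++ +0 ∷ []) ≡ suc n
    gaps = trans (length-++ σ) (trans (+-comm (length σ) 1) (cong suc len))
    extreme : ∀ {c} → Extreme c (+0 ∷ σ ++ +0 ∷ []) →
              ∑[ σ' ∈ insertions c σ ] f (desB⁰ σ') ≡ eulerStep (suc n) f (desB⁰ σ)
    extreme ext = trans (∑-insertions-extreme +0 σ +0 ext f) (cong (λ g → eulerStep g f (desB⁰ σ)) gaps)

-- Fails for 𝔅₀, where desB⁰ [] = 0 but 1 + des [] = 1, so the induction starts at n = 1.
∑-signedPerms≡2^n*∑-perms : ∀ n (f : ℕ → ℕ) →
  ∑[ σ ∈ signedPerms (suc n) ] f (desB⁰ σ) ≡ 2 ^ suc n * ∑[ π ∈ perms (suc n) ] f (suc (des π))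
∑-signedPerms≡2^n*∑-perms zero f = cong (λ x → x + (x + 0)) (sym (+-identityʳ (f 1)))
∑-signedPerms≡2^n*∑-perms (suc n) f = begin
    ∑[ σ ∈ signedPerms (suc (suc n)) ] f (desB⁰ σ)
  ≡⟨ ∑-signedPerms-suc (suc n) f ⟩
    ∑[ σ ∈ signedPerms (suc n) ] (2 * E (desB⁰ σ))
  ≡⟨ ∑-signedPerms≡2^n*∑-perms n (λ d → 2 * E d) ⟩
    2 ^ suc n * ∑[ π ∈ perms (suc n) ] (2 * E (suc (des π)))
  ≡⟨ cong (2 ^ suc n *_) (∑-*ˡ 2 (perms (suc n)) (E ∘ suc ∘ des)) ⟩
    2 ^ suc n * (2 * ∑[ π ∈ perms (suc n) ] E (suc (des π)))
  ≡⟨ sym (*-assoc (2 ^ suc n) 2 _) ⟩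
    2 ^ suc n * 2 * ∑[ π ∈ perms (suc n) ] E (suc (des π))
  ≡⟨ cong (_* ∑[ π ∈ perms (suc n) ] E (suc (des π))) (*-comm (2 ^ suc n) 2) ⟩
    2 ^ suc (suc n) * ∑[ π ∈ perms (suc n) ] E (suc (des π))
  ≡⟨ cong (2 ^ suc (suc n) *_) (sym (∑-perms-suc (suc n) f)) ⟩
    2 ^ suc (suc n) * ∑[ π ∈ perms (suc (suc n)) ] f (suc (des π))
  ∎
  where
  E : ℕ → ℕ
  E = eulerStep (suc (suc n)) f

desZ-++0 : ∀ u → desZ (u ++ +0 ∷ []) ≡ 𝟙 (lastPos u) + desZ u
desZ-++0 [] = refl
desZ-++0 (x ∷ []) = refl
desZ-++0 (x ∷ y ∷ u) = begin
    𝟙 ⌊ y ℤ.<? x ⌋ + desZ (y ∷ u ++ +0 ∷ [])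
  ≡⟨ cong (𝟙 ⌊ y ℤ.<? x ⌋ +_) (desZ-++0 (y ∷ u)) ⟩
    𝟙 ⌊ y ℤ.<? x ⌋ + (𝟙 (lastPos (y ∷ u)) + desZ (y ∷ u))
  ≡⟨ x∙yz≈y∙xz (𝟙 ⌊ y ℤ.<? x ⌋) (𝟙 (lastPos (y ∷ u))) (desZ (y ∷ u)) ⟩
    𝟙 (lastPos (y ∷ u)) + (𝟙 ⌊ y ℤ.<? x ⌋ + desZ (y ∷ u))
  ∎

desB⁰≡lastPos+desB : ∀ σ → desB⁰ σ ≡ 𝟙 (lastPos σ) + desB σ
desB⁰≡lastPos+desB [] = refl
desB⁰≡lastPos+desB (x ∷ σ) = desZ-++0 (+0 ∷ x ∷ σ)

lastNeg≡not-lastPos : ∀ x σ → All (λ z → 1 ≤ ∣ z ∣) (x ∷ σ) → lastNeg (x ∷ σ) ≡ not (lastPos (x ∷ σ))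
lastNeg≡not-lastPos +0 [] (() ∷ [])
lastNeg≡not-lastPos +[1+ m ] [] _ = refl
lastNeg≡not-lastPos -[1+ m ] [] _ = refl
lastNeg≡not-lastPos x (y ∷ σ) (_ ∷ ls) = lastNeg≡not-lastPos y σ ls

if-not+if : ∀ b (g : ℕ → ℕ) d → (if not b then g d else 0) + (if b then g (suc d) else 0) ≡ g (𝟙 b + d)
if-not+if true g d = refl
if-not+if false g d = +-identityʳ (g d)

weight-by-last-sign : ∀ x σ → All (λ z → 1 ≤ ∣ z ∣) (x ∷ σ) → (g : ℕ → ℕ) →
  (if lastNeg (x ∷ σ) then g (desB (x ∷ σ)) else 0) + (if lastPos (x ∷ σ) then g (suc (desB (x ∷ σ))) else 0)
    ≡ g (desB⁰ (x ∷ σ))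
weight-by-last-sign x σ ls g rewrite lastNeg≡not-lastPos x σ ls | desB⁰≡lastPos+desB (x ∷ σ) =
  if-not+if (lastPos (x ∷ σ)) g (desB (x ∷ σ))

B⁻+tB⁺≡∑-desB⁰ : ∀ n k → Bₙ⁻ (suc n) k + (t· Bₙ⁺ (suc n)) k ≡ ∑[ σ ∈ signedPerms (suc n) ] 𝟙 (k ≡ᵇ desB⁰ σ)
B⁻+tB⁺≡∑-desB⁰ n k = begin
    Bₙ⁻ (suc n) k + (t· Bₙ⁺ (suc n)) k
  ≡⟨ cong (Bₙ⁻ (suc n) k +_) (t·-genPoly desB (withLast lastPos) k) ⟩
    genPoly desB (withLast lastNeg) k + genPoly (suc ∘ desB) (withLast lastPos) k
  ≡⟨ cong₂ _+_ (genPoly-filterᵇ desB lastNeg 𝔅 k) (genPoly-filterᵇ (suc ∘ desB) lastPos 𝔅 k) ⟩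
    ∑ 𝔅 negative + ∑ 𝔅 positive
  ≡⟨ sym (∑-distrib-+ 𝔅 negative positive) ⟩
    ∑[ σ ∈ 𝔅 ] (negative σ + positive σ)
  ≡⟨ ∑-cong-All (All.zipWith by-last-sign (signedPerms-length (suc n) , signedPerms-letters (suc n))) ⟩
    ∑[ σ ∈ 𝔅 ] 𝟙 (k ≡ᵇ desB⁰ σ)
  ∎
  where
  𝔅 : List (List ℤ)
  𝔅 = signedPerms (suc n)
  withLast : (List ℤ → Bool) → List (List ℤ)
  withLast p = filter (λ σ → p σ Bool.≟ true) 𝔅
  negative positive : List ℤ → ℕ
  negative σ = if lastNeg σ then 𝟙 (k ≡ᵇ desB σ) else 0
  positive σ = if lastPos σ then 𝟙 (k ≡ᵇ suc (desB σ)) else 0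
  by-last-sign : ∀ {σ} → length σ ≡ suc n × All (InRange (suc n) ∘ ∣_∣) σ →
                 negative σ + positive σ ≡ 𝟙 (k ≡ᵇ desB⁰ σ)
  by-last-sign {x ∷ σ} (_ , ls) = weight-by-last-sign x σ (All.map proj₁ ls) (λ d → 𝟙 (k ≡ᵇ d))

lemma3p3 : (n : ℕ) → 1 Data.Nat.≤ n → (k : ℕ) →
    ((2 ^ n) • t· Aₙ n) k ≡ (Bₙ⁻ n ⊕ t· Bₙ⁺ n) k
lemma3p3 zero () k
lemma3p3 (suc n) _ k = begin
    2 ^ suc n * (t· Aₙ (suc n)) k
  ≡⟨ cong (2 ^ suc n *_) (trans (t·-genPoly des (perms (suc n)) k) (genPoly-∑ (suc ∘ des) (perms (suc n)) k)) ⟩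
    2 ^ suc n * ∑[ π ∈ perms (suc n) ] 𝟙 (k ≡ᵇ suc (des π))
  ≡⟨ sym (∑-signedPerms≡2^n*∑-perms n (λ d → 𝟙 (k ≡ᵇ d))) ⟩
    ∑[ σ ∈ signedPerms (suc n) ] 𝟙 (k ≡ᵇ desB⁰ σ)
  ≡⟨ sym (B⁻+tB⁺≡∑-desB⁰ n k) ⟩
    Bₙ⁻ (suc n) k + (t· Bₙ⁺ (suc n)) k
  ∎
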